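{- Let $G=(V,E,w)$ be a weighted undirected graph with $n=|V|$ vertices and conductance $\Phi_G$. Then every optimal HC tree $\mathcal{T}^*$ of $G$ (i.e. one with $\mathrm{cost}_G(\mathcal{T}^*)=\mathsf{OPT}_G$) satisfies \[ \mathrm{cost}_G(\mathcal{T}^*) \geq \frac{2\Phi_G}{9}\cdot \max\left\{\frac{\mathrm{vol}(G)^2}{d_{\max}},\ d_{\min}\cdot n^2\right\} = \frac{2\Phi_G}{9}\cdot n\cdot \mathrm{vol}(G)\cdot \max\left\{\frac{d_{\mathrm{avg}}}{d_{\max}},\ \frac{d_{\min}}{d_{\mathrm{avg}}}\right\}. \]
   Context: $G=(V,E,w)$ is an undirected graph with nonnegative edge weights $w_{uv}$. The degree of $u$ is $d_u=\sum_{v\in V} w_{uv}$; $d_{\min},d_{\max}$ are the minimum and maximum degrees and $d_{\mathrm{avg}}=\sum_{u\in V} d_u/n$. For $S\subseteq V$, $\mathrm{vol}(S)=\sum_{u\in S}d_u$, $\mathrm{vol}(G)=\mathrm{vol}(V)$, and for disjoint $S,T$, $w(S,T)$ is the total weight of edges between $S$ and $T$. The conductance of a nonempty $S$ is $\Phi_G(S)=w(S,V\setminus S)/\mathrm{vol}(S)$, and $\Phi_G=\min\{\Phi_G(S): \emptyset\neq S\subset V,\ \mathrm{vol}(S)\le \mathrm{vol}(V)/2\}$. An HC tree of $G$ is a rooted binary tree whose leaves are in bijection with $V$. Its cost is $\mathrm{cost}_G(\mathcal{T})=\sum_{e=\{u,v\}\in E} w_e\cdot |\mathsf{leaves}(\mathcal{T}[u\vee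 v])|$, where $u\vee v$ is the lowest common ancestor of $u,v$ and $\mathsf{leaves}(\mathcal{T}[N])$ is the set of leaves below node $N$. $\mathsf{OPT}_G$ is the minimum cost over all HC trees of $G$.
   Formalization: The edge weights $w_{uv}$ take values in the nonnegative rationals. -}

module Defs where

open import Data.Bool using (Bool; true; false; if_then_else_; _∧_; not)
open import Data.Nat as ℕ using (ℕ; zero; suc)
open import Data.Nat.Coprimality using (1-coprimeTo; sym)
open import Data.Fin using (Fin; toℕ) renaming (zero to fzero; suc to fsuc)
open import Data.Fin.Subset using (Subset; Nonempty)
open import Data.Fin.Properties using () renaming (_≟_ to _≟ᶠ_)
open import Data.Integer using (+_)
open import Data.List using (List; []; _∷_; _++_; length)
open import Data.List.Relation.Binary.Permutation.Propositional using (_↭_)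
open import Data.Product using (Σ; ∃; _×_; _,_)
open import Data.Rational using (ℚ; mkℚ; >-nonZero; 0ℚ; ½; _+_; _*_; _÷_; _⊔_; _⊓_; _≤_; _<_; Positive)
open import Data.Rational.Properties using (pos⇒nonZero; ≤-refl; p≤p⊔q; <-≤-trans; +-mono-<-≤; +-identityʳ; pos*pos⇒pos; 1/pos⇒pos; positive⁻¹)
open import Data.Rational using (positive; 1/_)
open import Data.Vec using (lookup)
open import Data.Vec.Functional using ()
open import Relation.Binary.PropositionalEquality using (_≡_; subst)
open import Relation.Nullary.Decidable using (⌊_⌋)
import Data.List as List

Σ[_] : ∀ {n} → (Fin n → ℚ) → ℚ
Σ[_] {zero}  f = 0ℚ
Σ[_] {suc n} f = f fzero + Σ[ (λ i → f (fsuc i)) ]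

maxF : ∀ {n} → (Fin (suc n) → ℚ) → ℚ
maxF {zero}  f = f fzero
maxF {suc n} f = f fzero ⊔ maxF (λ i → f (fsuc i))

minF : ∀ {n} → (Fin (suc n) → ℚ) → ℚ
minF {zero}  f = f fzero
minF {suc n} f = f fzero ⊓ minF (λ i → f (fsuc i))

-- the natural number k as a rational (k + 1, written so positivity is evident)
ℕ⁺→ℚ : ℕ → ℚ
ℕ⁺→ℚ m = mkℚ (+ suc m) 0 (sym (1-coprimeTo (suc m)))

ℕ→ℚ : ℕ → ℚ
ℕ→ℚ zero    = 0ℚ
ℕ→ℚ (suc m) = ℕ⁺→ℚ m

record Graph (n : ℕ) : Set where
  field
    w        : Fin n → Fin n → ℚ
    w-sym    : ∀ u v → w u v ≡ w v u
    w-nonneg : ∀ u v → 0ℚ ≤ w u v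
    w-noloop : ∀ u → w u u ≡ 0ℚ
open Graph public

module _ {n : ℕ} (G : Graph n) where

  deg : Fin n → ℚ
  deg u = Σ[ (λ v → w G u v) ]

  vol : Subset n → ℚ
  vol S = Σ[ (λ u → if lookup S u then deg u else 0ℚ) ]

  volG : ℚ
  volG = Σ[ deg ]

  cut : Subset n → ℚ
  cut S = Σ[ (λ u → Σ[ (λ v → if lookup S u ∧ not (lookup S v) then w G u v else 0ℚ) ]) ]

  condS : (S : Subset n) → 0ℚ < vol S → ℚ
  condS S p = _÷_ (cut S) (vol S) {{>-nonZero p}}

  Admissible : Subset n → Set
  Admissible S = Nonempty S × (vol S ≤ ½ * volG)

  IsConductance : ℚ → Set
  IsConductance Φ =
    (Σ (Subset n) λ S → Admissible S × Σ (0ℚ < vol S) λ p → Φ ≡ condS S p)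
    × (∀ S → Admissible S → (p : 0ℚ < vol S) → Φ ≤ condS S p)

data Tree (n : ℕ) : Set where
  leaf : Fin n → Tree n
  node : Tree n → Tree n → Tree n

leaves : ∀ {n} → Tree n → List (Fin n)
leaves (leaf v)   = v ∷ []
leaves (node l r) = leaves l ++ leaves r

IsHCTree : ∀ {n} → Tree n → Set
IsHCTree {n} T = leaves T ↭ List.allFin n

_∈ᵀ_ : ∀ {n} → Fin n → Tree n → Bool
u ∈ᵀ leaf v   = ⌊ u ≟ᶠ v ⌋
u ∈ᵀ node l r = (u ∈ᵀ l) Data.Bool.∨ (u ∈ᵀ r)

lcaLeaves : ∀ {n} → Tree n → Fin n → Fin n → ℕ
lcaLeaves (leaf _)     u v = 1
lcaLeaves T@(node l r) u v =
  if (u ∈ᵀ l) ∧ (v ∈ᵀ l) then lcaLeaves l u v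
  else if (u ∈ᵀ r) ∧ (v ∈ᵀ r) then lcaLeaves r u v
  else length (leaves T)

module _ {n : ℕ} (G : Graph n) where

  -- cost_G(T) = Σ_{ {u,v} ∈ E } w_uv · |leaves(T[u ∨ v])|
  -- (each unordered pair {u,v}, u ≠ v, counted once via toℕ u < toℕ v)
  cost : Tree n → ℚ
  cost T = Σ[ (λ u → Σ[ (λ v →
    if ⌊ toℕ u ℕ.<? toℕ v ⌋ then w G u v * ℕ→ℚ (lcaLeaves T u v) else 0ℚ) ]) ]

  IsOptimal : Tree n → Set
  IsOptimal T = IsHCTree T × (∀ T′ → IsHCTree T′ → cost T ≤ cost T′)

-- degree statistics for graphs on V = Fin (suc m), n = m + 1

module _ {m : ℕ} (G : Graph (suc m)) where

  dmax : ℚ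
  dmax = maxF (deg G)

  dmin : ℚ
  dmin = minF (deg G)

  davg : ℚ
  davg = _÷_ (volG G) (ℕ⁺→ℚ m) {{pos⇒nonZero (ℕ⁺→ℚ m)}}

-- positivity facts (needed only so that the divisions by d_max and
-- d_avg are well defined when all degrees are positive)

maxF-≥₀ : ∀ {n} (f : Fin (suc n) → ℚ) → f fzero ≤ maxF f
maxF-≥₀ {zero}  f = ≤-refl
maxF-≥₀ {suc n} f = p≤p⊔q (f fzero) _

Σ-pos : ∀ {n} (f : Fin (suc n) → ℚ) → (∀ i → 0ℚ < f i) → 0ℚ < Σ[ f ]
Σ-pos {zero} f p = subst (0ℚ <_) (Relation.Binary.PropositionalEquality.sym (+-identityʳ (f fzero))) (p fzero)
Σ-pos {suc n} f p = subst (_< (f fzero + Σ[ (λ i → f (fsuc i)) ])) (+-identityʳ 0ℚ) (+-mono-<-≤ (p fzero) (Data.Rational.Properties.<⇒≤ (Σ-pos (λ i → f (fsuc i)) (λ i → p (fsuc i)))))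

module _ {m : ℕ} (G : Graph (suc m)) (pos : ∀ u → 0ℚ < deg G u) where

  dmax-pos : 0ℚ < dmax G
  dmax-pos = <-≤-trans (pos fzero) (maxF-≥₀ (deg G))

  davg-pos : 0ℚ < davg G
  davg-pos = positive⁻¹ _ {{pos*pos⇒pos (volG G) {{positive (Σ-pos (deg G) pos)}} _ {{1/pos⇒pos (ℕ⁺→ℚ m)}}}}

{-# OPTIONS --safe #-}
-- Write cost(T) = Σ_N |N| · w(A, B) over the internal nodes N of T with children A, B.
-- Fix a threshold t. The maximal subtrees P with at most t leaves partition V, and the
-- weight crossing this partition, counted from both sides, is the sum of their cuts.
-- By the definition of conductance each cut is at least Φ · min(vol P, vol(V ∖ P)),
-- so the crossing weight is at least Φ · C_t for any 0 ≤ C_t ≤ vol(G) with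
-- C_t ≤ vol(V ∖ P) for all such P. Summing over t < n counts each node N exactly |N|
-- times, whence Φ · Σ_t C_t ≤ 2 cost(T). The choices C_t = max(0, vol(G) − t d_max)
-- and C_t = (n − t) d_min give Φ vol(G)²/d_max ≤ 4 cost(T) and Φ d_min n² ≤ 4 cost(T).
module Submission where

open import Defs
open import Data.Nat using (ℕ; suc)
open import Data.Integer using (+_)
open import Data.Rational using (ℚ; 0ℚ; _/_; _*_; _÷_; _⊔_; _≤_; _<_; >-nonZero)
open import Data.Product using (_×_)
open import Relation.Binary.PropositionalEquality using (_≡_)

open import Data.Bool using (Bool; true; false; if_then_else_; _∧_; _∨_; not)
import Data.Bool as Bool
open import Data.Bool.Properties using (∨-zeroʳ; ∧-comm; not-involutive)
open import Data.Empty using (⊥-elim)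
open import Data.Fin using (Fin; toℕ) renaming (zero to fzero; suc to fsuc)
import Data.Fin.Properties as FinP
open import Data.Fin.Subset.Properties using (nonempty?)
import Data.Integer as ℤ
import Data.Integer.Properties as ℤP
open import Data.List using (List; []; _∷_; _++_; length)
open import Data.List.Membership.Propositional using (_∈_)
open import Data.List.Membership.Propositional.Properties using (∈-++⁺ˡ; ∈-++⁺ʳ; ∈-++⁻; ∈-allFin)
open import Data.List.Properties using (length-++)
open import Data.List.Relation.Binary.Disjoint.Propositional using (Disjoint)
open import Data.List.Relation.Binary.Permutation.Propositional using (↭-sym; ↭⇒↭ₛ)
open import Data.List.Relation.Binary.Permutation.Propositional.Properties using (∈-resp-↭)
import Data.List.Relation.Binary.Permutation.Setoid.Properties as Permutationₛ
import Data.List.Relation.Unary.All as All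
import Data.List.Relation.Unary.All.Properties as All
open import Data.List.Relation.Unary.AllPairs using ([]; _∷_)
open import Data.List.Relation.Unary.Any using (here; there)
open import Data.List.Relation.Unary.Unique.Propositional using (Unique)
open import Data.List.Relation.Unary.Unique.Propositional.Properties using (allFin⁺)
open import Data.Nat as ℕ using (zero; _∸_; _<ᵇ_)
import Data.Nat.Properties as ℕP
open import Data.Product using (_,_; proj₁; proj₂)
open import Data.Rational using (1ℚ; _+_; _-_; -_; ½; _⊓_; NonZero; 1/_; nonNegative; positive)
import Data.Rational.Properties as ℚP
open import Data.Rational.Solver using (module +-*-Solver)
open +-*-Solver using (solve; _:=_; _:+_; _:*_; _:-_; con)
open import Data.Sum using (_⊎_; inj₁; inj₂)
open import Data.Unit using (⊤; tt)
open import Data.Vec using (lookup; tabulate)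
open import Data.Vec.Properties using (lookup∘tabulate; lookup⇒[]=; []=⇒lookup)
open import Relation.Binary.PropositionalEquality
  using (refl; sym; trans; cong; cong₂; subst; subst₂; setoid; module ≡-Reasoning)
open import Relation.Nullary using (yes; no)
open import Relation.Nullary.Decidable using (⌊_⌋)

-- 1ℚ + ℕ→ℚ (suc k) unfolds to the normalised fraction (1 · 1 + (k + 1) · 1) / 1.
ℕ→ℚ-suc : ∀ k → ℕ→ℚ (suc k) ≡ 1ℚ + ℕ→ℚ k
ℕ→ℚ-suc zero    = refl
ℕ→ℚ-suc (suc k) = trans (sym (ℚP.↥p/↧p≡p (ℕ→ℚ (suc (suc k)))))
  (ℚP./-cong {+ suc (suc k)} {1} (cong (λ z → + 1 ℤ.+ z) (sym (ℤP.*-identityʳ (+ suc k)))) refl)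

ℕ→ℚ-+ : ∀ a b → ℕ→ℚ (a ℕ.+ b) ≡ ℕ→ℚ a + ℕ→ℚ b
ℕ→ℚ-+ zero    b = sym (ℚP.+-identityˡ _)
ℕ→ℚ-+ (suc a) b = begin
  ℕ→ℚ (suc (a ℕ.+ b))    ≡⟨ ℕ→ℚ-suc (a ℕ.+ b) ⟩
  1ℚ + ℕ→ℚ (a ℕ.+ b)     ≡⟨ cong (_+_ 1ℚ) (ℕ→ℚ-+ a b) ⟩
  1ℚ + (ℕ→ℚ a + ℕ→ℚ b)   ≡⟨ sym (ℚP.+-assoc 1ℚ (ℕ→ℚ a) (ℕ→ℚ b)) ⟩
  (1ℚ + ℕ→ℚ a) + ℕ→ℚ b   ≡⟨ cong (_+ ℕ→ℚ b) (sym (ℕ→ℚ-suc a)) ⟩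
  ℕ→ℚ (suc a) + ℕ→ℚ b    ∎
  where open ≡-Reasoning

+-nonNeg : ∀ {p q} → 0ℚ ≤ p → 0ℚ ≤ q → 0ℚ ≤ p + q
+-nonNeg = ℚP.+-mono-≤

*-nonNeg : ∀ {p q} → 0ℚ ≤ p → 0ℚ ≤ q → 0ℚ ≤ p * q
*-nonNeg {p} {q} 0≤p 0≤q = subst (_≤ p * q) (ℚP.*-zeroʳ p) (ℚP.*-monoˡ-≤-nonNeg p {{nonNegative 0≤p}} 0≤q)

*-monoʳ-≤-0≤ : ∀ {r p q} → 0ℚ ≤ r → p ≤ q → r * p ≤ r * q
*-monoʳ-≤-0≤ {r} 0≤r = ℚP.*-monoˡ-≤-nonNeg r {{nonNegative 0≤r}}

0≤1 : 0ℚ ≤ 1ℚ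
0≤1 = ℚP.≤ᵇ⇒≤ tt

ℕ→ℚ-nonNeg : ∀ k → 0ℚ ≤ ℕ→ℚ k
ℕ→ℚ-nonNeg zero    = ℚP.≤-refl
ℕ→ℚ-nonNeg (suc k) = subst (0ℚ ≤_) (sym (ℕ→ℚ-suc k)) (+-nonNeg 0≤1 (ℕ→ℚ-nonNeg k))

ℕ→ℚ-mono-≤ : ∀ {a b} → a ℕ.≤ b → ℕ→ℚ a ≤ ℕ→ℚ b
ℕ→ℚ-mono-≤ {a} a≤b with ℕP.m≤n⇒∃[o]m+o≡n a≤b
... | o , refl = subst₂ _≤_ (ℚP.+-identityʳ (ℕ→ℚ a)) (sym (ℕ→ℚ-+ a o))
                   (ℚP.+-monoʳ-≤ (ℕ→ℚ a) (ℕ→ℚ-nonNeg o))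

p≤q⇒0≤q-p : ∀ {p q} → p ≤ q → 0ℚ ≤ q - p
p≤q⇒0≤q-p {p} {q} p≤q = subst (_≤ q - p) (ℚP.+-inverseʳ p) (ℚP.+-monoˡ-≤ (- p) p≤q)

0≤q-p⇒p≤q : ∀ {p q} → 0ℚ ≤ q - p → p ≤ q
0≤q-p⇒p≤q {p} {q} 0≤q-p = subst₂ _≤_ (ℚP.+-identityʳ p)
  (solve 2 (λ p q → p :+ (q :- p) := q) refl p q) (ℚP.+-monoʳ-≤ p 0≤q-p)

≤-by-difference : ∀ {p q d} → 0ℚ ≤ d → q - p ≡ d → p ≤ q
≤-by-difference 0≤d q-p≡d = 0≤q-p⇒p≤q (subst (0ℚ ≤_) (sym q-p≡d) 0≤d)

⊓-subadditive : ∀ {p q r} c → 0ℚ ≤ p → 0ℚ ≤ q → 0ℚ ≤ c → r ≤ p + q → r ⊓ c ≤ p ⊓ c + q ⊓ c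
⊓-subadditive {p} {q} {r} c 0≤p 0≤q 0≤c r≤p+q with ℚP.≤-total p c | ℚP.≤-total q c
... | inj₁ p≤c | inj₁ q≤c = ℚP.≤-trans (ℚP.p⊓q≤p r c)
  (subst₂ (λ x y → r ≤ x + y) (sym (ℚP.p≤q⇒p⊓q≡p p≤c)) (sym (ℚP.p≤q⇒p⊓q≡p q≤c)) r≤p+q)
... | inj₁ p≤c | inj₂ c≤q = ℚP.≤-trans (ℚP.p⊓q≤q r c)
  (subst (λ x → c ≤ p ⊓ c + x) (sym (ℚP.p≥q⇒p⊓q≡q c≤q))
    (subst (_≤ p ⊓ c + c) (ℚP.+-identityˡ c) (ℚP.+-monoˡ-≤ c (ℚP.⊓-glb 0≤p 0≤c))))
... | inj₂ c≤p | _ = ℚP.≤-trans (ℚP.p⊓q≤q r c)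
  (subst (λ x → c ≤ x + q ⊓ c) (sym (ℚP.p≥q⇒p⊓q≡q c≤p))
    (subst (_≤ c + q ⊓ c) (ℚP.+-identityʳ c) (ℚP.+-monoʳ-≤ c (ℚP.⊓-glb 0≤q 0≤c))))

when : Bool → ℚ → ℚ
when b x = if b then x else 0ℚ

when-nonNeg : ∀ b {x} → 0ℚ ≤ x → 0ℚ ≤ when b x
when-nonNeg true  0≤x = 0≤x
when-nonNeg false _   = ℚP.≤-refl

when-0 : ∀ b → when b 0ℚ ≡ 0ℚ
when-0 true  = refl
when-0 false = refl

when≡when1* : ∀ b x → when b x ≡ when b 1ℚ * x
when≡when1* true  x = sym (ℚP.*-identityˡ x)
when≡when1* false x = sym (ℚP.*-zeroˡ x)

when-∨-≤ : ∀ b c {x} → 0ℚ ≤ x → when (b ∨ c) x ≤ when b x + when c x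
when-∨-≤ true  true  {x} 0≤x = subst (_≤ x + x) (ℚP.+-identityʳ x) (ℚP.+-monoʳ-≤ x 0≤x)
when-∨-≤ true  false {x} _   = ℚP.≤-reflexive (sym (ℚP.+-identityʳ x))
when-∨-≤ false true  {x} _   = ℚP.≤-reflexive (sym (ℚP.+-identityˡ x))
when-∨-≤ false false     _   = ℚP.≤-refl

when+when-not : ∀ b x → when b x + when (not b) x ≡ x
when+when-not true  x = ℚP.+-identityʳ x
when+when-not false x = ℚP.+-identityˡ x

x*[p*1/p]≡x : ∀ x p .{{_ : NonZero p}} → x * (p * 1/ p) ≡ x
x*[p*1/p]≡x x p = trans (cong (x *_) (ℚP.*-inverseʳ p)) (ℚP.*-identityʳ x)

÷-*-cancel : ∀ p q .{{_ : NonZero q}} → (p ÷ q) * q ≡ p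
÷-*-cancel p q = trans (ℚP.*-assoc p (1/ q) q) (trans (cong (p *_) (ℚP.*-inverseˡ q)) (ℚP.*-identityʳ p))

1/-pos : ∀ {q} (0<q : 0ℚ < q) → 0ℚ < (1/ q) {{>-nonZero 0<q}}
1/-pos {q} 0<q = ℚP.positive⁻¹ _ {{ℚP.1/pos⇒pos q {{positive 0<q}}}}

x≤[D+D]*s⇒x÷D≤s+s : ∀ {x s D} (0<D : 0ℚ < D) → x ≤ (D + D) * s → _÷_ x D {{>-nonZero 0<D}} ≤ s + s
x≤[D+D]*s⇒x÷D≤s+s {x} {s} {D} 0<D x≤2Ds = begin
  x * iD                 ≤⟨ ℚP.*-monoʳ-≤-nonNeg iD {{nonNegative (ℚP.<⇒≤ (1/-pos 0<D))}} x≤2Ds ⟩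
  (D + D) * s * iD       ≡⟨ solve 3 (λ D s iD → (D :+ D) :* s :* iD := (s :+ s) :* (D :* iD)) refl D s iD ⟩
  (s + s) * (D * iD)     ≡⟨ x*[p*1/p]≡x (s + s) D {{>-nonZero 0<D}} ⟩
  s + s                  ∎
  where
  open ℚP.≤-Reasoning
  iD = (1/ D) {{>-nonZero 0<D}}

<ᵇ≡false⇒≥ : ∀ {m n} → (m <ᵇ n) ≡ false → n ℕ.≤ m
<ᵇ≡false⇒≥ m<ᵇn≡false = ℕP.≮⇒≥ (λ m<n → subst Bool.T m<ᵇn≡false (ℕP.<⇒<ᵇ m<n))

Σ-cong : ∀ {n} {f g : Fin n → ℚ} → (∀ i → f i ≡ g i) → Σ[ f ] ≡ Σ[ g ]
Σ-cong {zero}  f≡g = refl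
Σ-cong {suc n} f≡g = cong₂ _+_ (f≡g fzero) (Σ-cong (λ i → f≡g (fsuc i)))

Σ-distrib-+ : ∀ {n} (f g : Fin n → ℚ) → Σ[ (λ i → f i + g i) ] ≡ Σ[ f ] + Σ[ g ]
Σ-distrib-+ {zero}  f g = refl
Σ-distrib-+ {suc n} f g =
  trans (cong (_+_ (f fzero + g fzero)) (Σ-distrib-+ (λ i → f (fsuc i)) (λ i → g (fsuc i))))
        (solve 4 (λ a b c d → (a :+ b) :+ (c :+ d) := (a :+ c) :+ (b :+ d)) refl (f fzero) (g fzero) _ _)

Σ-distribˡ-* : ∀ {n} c (f : Fin n → ℚ) → Σ[ (λ i → c * f i) ] ≡ c * Σ[ f ]
Σ-distribˡ-* {zero}  c f = sym (ℚP.*-zeroʳ c)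
Σ-distribˡ-* {suc n} c f = trans (cong (_+_ (c * f fzero)) (Σ-distribˡ-* c (λ i → f (fsuc i))))
                                 (sym (ℚP.*-distribˡ-+ c (f fzero) _))

Σ-zero : ∀ n → Σ[ (λ (_ : Fin n) → 0ℚ) ] ≡ 0ℚ
Σ-zero zero    = refl
Σ-zero (suc n) = cong (_+_ 0ℚ) (Σ-zero n)

Σ-one : ∀ n → Σ[ (λ (_ : Fin n) → 1ℚ) ] ≡ ℕ→ℚ n
Σ-one zero    = refl
Σ-one (suc n) = trans (cong (_+_ 1ℚ) (Σ-one n)) (sym (ℕ→ℚ-suc n))

Σ-mono-≤ : ∀ {n} {f g : Fin n → ℚ} → (∀ i → f i ≤ g i) → Σ[ f ] ≤ Σ[ g ]
Σ-mono-≤ {zero}  f≤g = ℚP.≤-refl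
Σ-mono-≤ {suc n} f≤g = ℚP.+-mono-≤ (f≤g fzero) (Σ-mono-≤ (λ i → f≤g (fsuc i)))

Σ-nonNeg : ∀ {n} {f : Fin n → ℚ} → (∀ i → 0ℚ ≤ f i) → 0ℚ ≤ Σ[ f ]
Σ-nonNeg {n} {f} 0≤f = subst (_≤ Σ[ f ]) (Σ-zero n) (Σ-mono-≤ 0≤f)

Σ-comm : ∀ {n m} (F : Fin n → Fin m → ℚ) →
         Σ[ (λ i → Σ[ (λ j → F i j) ]) ] ≡ Σ[ (λ j → Σ[ (λ i → F i j) ]) ]
Σ-comm {zero}  {m} F = sym (Σ-zero m)
Σ-comm {suc n}     F = trans (cong (_+_ (Σ[ F fzero ])) (Σ-comm (λ i j → F (fsuc i) j)))
                             (sym (Σ-distrib-+ (F fzero) (λ j → Σ[ (λ i → F (fsuc i) j) ])))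

term≤Σ : ∀ {n} {f : Fin n → ℚ} → (∀ i → 0ℚ ≤ f i) → ∀ j → f j ≤ Σ[ f ]
term≤Σ {suc n} {f} 0≤f fzero =
  subst (_≤ Σ[ f ]) (ℚP.+-identityʳ (f fzero)) (ℚP.+-monoʳ-≤ (f fzero) (Σ-nonNeg (λ i → 0≤f (fsuc i))))
term≤Σ {suc n} {f} 0≤f (fsuc j) =
  subst (_≤ Σ[ f ]) (ℚP.+-identityˡ (f (fsuc j))) (ℚP.+-mono-≤ (0≤f fzero) (term≤Σ (λ i → 0≤f (fsuc i)) j))

Σ-when-≡ : ∀ {n} (f : Fin n → ℚ) u → Σ[ (λ x → when ⌊ x FinP.≟ u ⌋ (f x)) ] ≡ f u
Σ-when-≡ {suc n} f fzero    = trans (cong (_+_ (f fzero)) (Σ-zero n)) (ℚP.+-identityʳ (f fzero))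
Σ-when-≡ {suc n} f (fsuc u) = trans (ℚP.+-identityˡ _)
  (trans (Σ-cong (λ x → cong (λ b → when b (f (fsuc x))) (≟-fsuc x u))) (Σ-when-≡ (λ i → f (fsuc i)) u))
  where
  ≟-fsuc : ∀ {n} (x y : Fin n) → ⌊ fsuc x FinP.≟ fsuc y ⌋ ≡ ⌊ x FinP.≟ y ⌋
  ≟-fsuc x y with x FinP.≟ y | fsuc x FinP.≟ fsuc y
  ... | yes _   | yes _    = refl
  ... | no  _   | no  _    = refl
  ... | yes x≡y | no  sx≢sy = ⊥-elim (sx≢sy (cong fsuc x≡y))
  ... | no  x≢y | yes sx≡sy = ⊥-elim (x≢y (FinP.suc-injective sx≡sy))

Σ²[_] : ∀ {n} → (Fin n → Fin n → ℚ) → ℚ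
Σ²[ F ] = Σ[ (λ u → Σ[ (λ v → F u v) ]) ]

Σ²-cong : ∀ {n} {F H : Fin n → Fin n → ℚ} → (∀ u v → F u v ≡ H u v) → Σ²[ F ] ≡ Σ²[ H ]
Σ²-cong F≡H = Σ-cong (λ u → Σ-cong (F≡H u))

Σ²-distrib-+ : ∀ {n} (F H : Fin n → Fin n → ℚ) → Σ²[ (λ u v → F u v + H u v) ] ≡ Σ²[ F ] + Σ²[ H ]
Σ²-distrib-+ F H = trans (Σ-cong (λ u → Σ-distrib-+ (F u) (H u)))
                         (Σ-distrib-+ (λ u → Σ[ F u ]) (λ u → Σ[ H u ]))

Σ²-distribˡ-* : ∀ {n} c (F : Fin n → Fin n → ℚ) → Σ²[ (λ u v → c * F u v) ] ≡ c * Σ²[ F ]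
Σ²-distribˡ-* c F = trans (Σ-cong (λ u → Σ-distribˡ-* c (F u))) (Σ-distribˡ-* c (λ u → Σ[ F u ]))

Σ²-nonNeg : ∀ {n} {F : Fin n → Fin n → ℚ} → (∀ u v → 0ℚ ≤ F u v) → 0ℚ ≤ Σ²[ F ]
Σ²-nonNeg 0≤F = Σ-nonNeg (λ u → Σ-nonNeg (0≤F u))

Σ²-transpose : ∀ {n} (F : Fin n → Fin n → ℚ) → Σ²[ (λ u v → F v u) ] ≡ Σ²[ F ]
Σ²-transpose F = Σ-comm (λ u v → F v u)

Σ< : ℕ → (ℕ → ℚ) → ℚ
Σ< K f = Σ[ (λ (i : Fin K) → f (toℕ i)) ]

Σ<-when-<ᵇ : ∀ K N → Σ< K (λ t → when (t <ᵇ N) 1ℚ) ≤ ℕ→ℚ N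
Σ<-when-<ᵇ zero    N       = ℕ→ℚ-nonNeg N
Σ<-when-<ᵇ (suc K) zero    = subst (_≤ 0ℚ) (sym (ℚP.+-identityˡ _)) (Σ<-when-<ᵇ K zero)
Σ<-when-<ᵇ (suc K) (suc N) = subst (1ℚ + Σ< K (λ t → when (t <ᵇ N) 1ℚ) ≤_) (sym (ℕ→ℚ-suc N))
                               (ℚP.+-monoʳ-≤ 1ℚ (Σ<-when-<ᵇ K N))

maxF-upper : ∀ {n} (f : Fin (suc n) → ℚ) i → f i ≤ maxF f
maxF-upper {zero}  f fzero    = ℚP.≤-refl
maxF-upper {suc n} f fzero    = ℚP.p≤p⊔q (f fzero) _
maxF-upper {suc n} f (fsuc i) = ℚP.≤-trans (maxF-upper (λ j → f (fsuc j)) i) (ℚP.p≤q⊔p (f fzero) _)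

minF-lower : ∀ {n} (f : Fin (suc n) → ℚ) i → minF f ≤ f i
minF-lower {zero}  f fzero    = ℚP.≤-refl
minF-lower {suc n} f fzero    = ℚP.p⊓q≤p (f fzero) _
minF-lower {suc n} f (fsuc i) = ℚP.≤-trans (ℚP.p⊓q≤q (f fzero) _) (minF-lower (λ j → f (fsuc j)) i)

minF-glb : ∀ {n} (f : Fin (suc n) → ℚ) {c} → (∀ i → c ≤ f i) → c ≤ minF f
minF-glb {zero}  f c≤f = c≤f fzero
minF-glb {suc n} f c≤f = ℚP.⊓-glb (c≤f fzero) (minF-glb (λ j → f (fsuc j)) (λ j → c≤f (fsuc j)))

-- Two discrete integrals

ramp : ℚ → ℚ → ℕ → ℚ
ramp V D t = 0ℚ ⊔ (V - ℕ→ℚ t * D)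

ramp-nonNeg : ∀ V D t → 0ℚ ≤ ramp V D t
ramp-nonNeg V D t = ℚP.p≤p⊔q 0ℚ (V - ℕ→ℚ t * D)

Σ<-ramp-suc : ∀ N {V} D → 0ℚ ≤ V → Σ< (suc N) (ramp V D) ≡ V + Σ< N (ramp (V - D) D)
Σ<-ramp-suc N {V} D 0≤V = cong₂ _+_ ramp-0 (Σ-cong {N} (λ i → ramp-suc (toℕ i)))
  where
  ramp-0 : ramp V D 0 ≡ V
  ramp-0 = trans (cong (0ℚ ⊔_) (solve 2 (λ V D → V :- con 0ℚ :* D := V) refl V D)) (ℚP.p≤q⇒p⊔q≡q 0≤V)
  ramp-suc : ∀ t → ramp V D (suc t) ≡ ramp (V - D) D t
  ramp-suc t = cong (0ℚ ⊔_) (trans (cong (λ k → V - k * D) (ℕ→ℚ-suc t))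
    (solve 3 (λ V D k → V :- (con 1ℚ :+ k) :* D := (V :- D) :- k :* D) refl V D (ℕ→ℚ t)))

-- Discrete version of ∫₀^{V/D} (V - tD) dt = V²/2D.
V²≤2D*Σ<ramp : ∀ N {V D} → 0ℚ ≤ V → 0ℚ ≤ D → V ≤ ℕ→ℚ N * D → V * V ≤ (D + D) * Σ< N (ramp V D)
V²≤2D*Σ<ramp zero {V} {D} 0≤V _ V≤0*D =
  subst (λ x → x * x ≤ (D + D) * 0ℚ) (sym V≡0) (ℚP.≤-reflexive (sym (ℚP.*-zeroʳ (D + D))))
  where
  V≡0 : V ≡ 0ℚ
  V≡0 = ℚP.≤-antisym (subst (V ≤_) (ℚP.*-zeroˡ D) V≤0*D) 0≤V
V²≤2D*Σ<ramp (suc N) {V} {D} 0≤V 0≤D V≤[N+1]D =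
  subst (λ s → V * V ≤ (D + D) * s) (sym (Σ<-ramp-suc N D 0≤V)) (split (ℚP.≤-total V D))
  where
  open ℚP.≤-Reasoning
  rest = Σ< N (ramp (V - D) D)
  0≤rest : 0ℚ ≤ rest
  0≤rest = Σ-nonNeg {N} (λ i → ramp-nonNeg (V - D) D (toℕ i))
  split : V ≤ D ⊎ D ≤ V → V * V ≤ (D + D) * (V + rest)
  split (inj₁ V≤D) = begin
    V * V                ≤⟨ ≤-by-difference (*-nonNeg 0≤V (+-nonNeg (p≤q⇒0≤q-p V≤D) 0≤D))
                              (solve 2 (λ V D → (D :+ D) :* V :- V :* V := V :* ((D :- V) :+ D)) refl V D) ⟩
    (D + D) * V          ≤⟨ *-monoʳ-≤-0≤ (+-nonNeg 0≤D 0≤D)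
                              (subst (_≤ V + rest) (ℚP.+-identityʳ V) (ℚP.+-monoʳ-≤ V 0≤rest)) ⟩
    (D + D) * (V + rest) ∎
  split (inj₂ D≤V) = begin
    V * V                           ≤⟨ ≤-by-difference (*-nonNeg 0≤D 0≤D)
      (solve 2 (λ V D → ((D :+ D) :* V :+ (V :- D) :* (V :- D)) :- V :* V := D :* D) refl V D) ⟩
    (D + D) * V + (V - D) * (V - D) ≤⟨ ℚP.+-monoʳ-≤ ((D + D) * V)
                                         (V²≤2D*Σ<ramp N (p≤q⇒0≤q-p D≤V) 0≤D V-D≤ND) ⟩
    (D + D) * V + (D + D) * rest    ≡⟨ sym (ℚP.*-distribˡ-+ (D + D) V rest) ⟩
    (D + D) * (V + rest)            ∎
    where
    V-D≤ND : V - D ≤ ℕ→ℚ N * D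
    V-D≤ND = ≤-by-difference (p≤q⇒0≤q-p (subst (λ k → V ≤ k * D) (ℕ→ℚ-suc N) V≤[N+1]D))
      (solve 3 (λ V D k → k :* D :- (V :- D) := (con 1ℚ :+ k) :* D :- V) refl V D (ℕ→ℚ N))

N²≤2*Σ<[N∸t] : ∀ N → ℕ→ℚ N * ℕ→ℚ N ≤ Σ< N (λ t → ℕ→ℚ (N ∸ t)) + Σ< N (λ t → ℕ→ℚ (N ∸ t))
N²≤2*Σ<[N∸t] zero    = ℚP.≤-refl
N²≤2*Σ<[N∸t] (suc N) = subst (λ k → k * k ≤ (k + S) + (k + S)) (sym (ℕ→ℚ-suc N))
  (≤-by-difference (+-nonNeg 0≤1 (p≤q⇒0≤q-p (N²≤2*Σ<[N∸t] N)))
    (solve 2 (λ k S → ((con 1ℚ :+ k) :+ S) :+ ((con 1ℚ :+ k) :+ S) :- (con 1ℚ :+ k) :* (con 1ℚ :+ k)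
                      := con 1ℚ :+ ((S :+ S) :- k :* k)) refl (ℕ→ℚ N) S))
  where
  S = Σ< N (λ t → ℕ→ℚ (N ∸ t))

⟦_⟧ : ∀ {n} → Tree n → Fin n → Bool
⟦ T ⟧ u = u ∈ᵀ T

#leaves : ∀ {n} → Tree n → ℕ
#leaves T = length (leaves T)

∈ᵀ⇒∈leaves : ∀ {n} (T : Tree n) {u} → ⟦ T ⟧ u ≡ true → u ∈ leaves T
∈ᵀ⇒∈leaves (leaf v) {u} u∈T with u FinP.≟ v
... | yes u≡v = here u≡v
∈ᵀ⇒∈leaves (node L R) {u} u∈T with ⟦ L ⟧ u in u∈L | ⟦ R ⟧ u in u∈R
... | true  | _    = ∈-++⁺ˡ (∈ᵀ⇒∈leaves L u∈L)
... | false | true = ∈-++⁺ʳ (leaves L) (∈ᵀ⇒∈leaves R u∈R)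

∈leaves⇒∈ᵀ : ∀ {n} (T : Tree n) {u} → u ∈ leaves T → ⟦ T ⟧ u ≡ true
∈leaves⇒∈ᵀ (leaf v) (here refl) with v FinP.≟ v
... | yes _   = refl
... | no  v≢v = ⊥-elim (v≢v refl)
∈leaves⇒∈ᵀ (node L R) {u} u∈T with ∈-++⁻ (leaves L) u∈T
... | inj₁ u∈L rewrite ∈leaves⇒∈ᵀ L u∈L = refl
... | inj₂ u∈R rewrite ∈leaves⇒∈ᵀ R u∈R = ∨-zeroʳ (⟦ L ⟧ u)

DisjointSplits : ∀ {n} → Tree n → Set
DisjointSplits (leaf _)   = ⊤
DisjointSplits (node L R) = DisjointSplits L × DisjointSplits R × (∀ u → ⟦ L ⟧ u ∧ ⟦ R ⟧ u ≡ false)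

Unique-++⁻ : ∀ {n} (xs : List (Fin n)) {ys} → Unique (xs ++ ys) → Unique xs × Unique ys × Disjoint xs ys
Unique-++⁻ []       ys! = [] , ys! , λ ()
Unique-++⁻ (x ∷ xs) (x∉xs++ys ∷ xs++ys!) with Unique-++⁻ xs xs++ys!
... | xs! , ys! , xs#ys = (All.++⁻ˡ xs x∉xs++ys ∷ xs!) , ys! , x∷xs#ys
  where
  x∷xs#ys : Disjoint (x ∷ xs) _
  x∷xs#ys (here refl  , v∈ys) = All.lookup (All.++⁻ʳ xs x∉xs++ys) v∈ys refl
  x∷xs#ys (there v∈xs , v∈ys) = xs#ys (v∈xs , v∈ys)

Unique⇒DisjointSplits : ∀ {n} (T : Tree n) → Unique (leaves T) → DisjointSplits T
Unique⇒DisjointSplits (leaf _)   _ = tt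
Unique⇒DisjointSplits (node L R) leaves! with Unique-++⁻ (leaves L) leaves!
... | L! , R! , L#R = Unique⇒DisjointSplits L L! , Unique⇒DisjointSplits R R! , disjoint
  where
  disjoint : ∀ u → ⟦ L ⟧ u ∧ ⟦ R ⟧ u ≡ false
  disjoint u with ⟦ L ⟧ u in u∈L | ⟦ R ⟧ u in u∈R
  ... | true  | true  = ⊥-elim (L#R (∈ᵀ⇒∈leaves L u∈L , ∈ᵀ⇒∈leaves R u∈R))
  ... | true  | false = refl
  ... | false | _     = refl

IsHCTree⇒DisjointSplits : ∀ {n} (T : Tree n) → IsHCTree T → DisjointSplits T
IsHCTree⇒DisjointSplits {n} T T↭V =
  Unique⇒DisjointSplits T (Permutationₛ.Unique-resp-↭ (setoid _) (↭⇒↭ₛ (↭-sym T↭V)) (allFin⁺ n))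

IsHCTree⇒∈ᵀ : ∀ {n} (T : Tree n) → IsHCTree T → ∀ u → ⟦ T ⟧ u ≡ true
IsHCTree⇒∈ᵀ T T↭V u = ∈leaves⇒∈ᵀ T (∈-resp-↭ (↭-sym T↭V) (∈-allFin u))

-- Vertex sets as Boolean predicates

_∪ᵖ_ : ∀ {n} → (Fin n → Bool) → (Fin n → Bool) → Fin n → Bool
(a ∪ᵖ b) u = a u ∨ b u

∁ᵖ : ∀ {n} → (Fin n → Bool) → Fin n → Bool
∁ᵖ a u = not (a u)

∣_∣ᵖ : ∀ {n} → (Fin n → Bool) → ℚ
∣ a ∣ᵖ = Σ[ (λ u → when (a u) 1ℚ) ]

Σ-when+Σ-when-∁ : ∀ {n} (a : Fin n → Bool) (f : Fin n → ℚ) →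
                  Σ[ (λ u → when (a u) (f u)) ] + Σ[ (λ u → when (∁ᵖ a u) (f u)) ] ≡ Σ[ f ]
Σ-when+Σ-when-∁ a f = trans (sym (Σ-distrib-+ (λ u → when (a u) (f u)) (λ u → when (∁ᵖ a u) (f u))))
                            (Σ-cong (λ u → when+when-not (a u) (f u)))

Σ-when-∪ : ∀ {n} (a b : Fin n → Bool) {f : Fin n → ℚ} → (∀ u → 0ℚ ≤ f u) →
           Σ[ (λ u → when ((a ∪ᵖ b) u) (f u)) ]
           ≤ Σ[ (λ u → when (a u) (f u)) ] + Σ[ (λ u → when (b u) (f u)) ]
Σ-when-∪ a b {f} 0≤f = subst (Σ[ (λ u → when ((a ∪ᵖ b) u) (f u)) ] ≤_)
  (Σ-distrib-+ (λ u → when (a u) (f u)) (λ u → when (b u) (f u)))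
  (Σ-mono-≤ (λ u → when-∨-≤ (a u) (b u) (0≤f u)))

∣∣-nonNeg : ∀ {n} (a : Fin n → Bool) → 0ℚ ≤ ∣ a ∣ᵖ
∣∣-nonNeg a = Σ-nonNeg (λ u → when-nonNeg (a u) 0≤1)

∣∁∣≥n∸t : ∀ {n} (a : Fin n → Bool) t → ∣ a ∣ᵖ ≤ ℕ→ℚ t → ℕ→ℚ (n ∸ t) ≤ ∣ ∁ᵖ a ∣ᵖ
∣∁∣≥n∸t {n} a t ∣a∣≤t with t ℕ.≤? n
... | no  t≰n = subst (λ k → ℕ→ℚ k ≤ ∣ ∁ᵖ a ∣ᵖ) (sym (ℕP.m≤n⇒m∸n≡0 (ℕP.≰⇒≥ t≰n))) (∣∣-nonNeg (∁ᵖ a))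
... | yes t≤n = ≤-by-difference (p≤q⇒0≤q-p ∣a∣≤t) (begin
  q - x              ≡⟨ solve 3 (λ p q x → q :- x := ((p :+ q) :- x) :- p) refl p q x ⟩
  ((p + q) - x) - p  ≡⟨ cong (λ z → (z - x) - p) p+q≡x+y ⟩
  ((x + y) - x) - p  ≡⟨ solve 3 (λ x y p → ((x :+ y) :- x) :- p := y :- p) refl x y p ⟩
  y - p              ∎)
  where
  open ≡-Reasoning
  p = ∣ a ∣ᵖ
  q = ∣ ∁ᵖ a ∣ᵖ
  x = ℕ→ℚ (n ∸ t)
  y = ℕ→ℚ t
  p+q≡x+y : p + q ≡ x + y
  p+q≡x+y = trans (Σ-when+Σ-when-∁ a (λ _ → 1ℚ))
    (trans (Σ-one n) (trans (cong ℕ→ℚ (sym (ℕP.m∸n+n≡m t≤n))) (ℕ→ℚ-+ (n ∸ t) t)))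

∣⟦⟧∣≤#leaves : ∀ {n} (T : Tree n) → ∣ ⟦ T ⟧ ∣ᵖ ≤ ℕ→ℚ (#leaves T)
∣⟦⟧∣≤#leaves (leaf u)   = ℚP.≤-reflexive (Σ-when-≡ (λ _ → 1ℚ) u)
∣⟦⟧∣≤#leaves (node L R) = ℚP.≤-trans (Σ-when-∪ ⟦ L ⟧ ⟦ R ⟧ (λ _ → 0≤1))
  (subst (∣ ⟦ L ⟧ ∣ᵖ + ∣ ⟦ R ⟧ ∣ᵖ ≤_)
         (trans (sym (ℕ→ℚ-+ (#leaves L) (#leaves R))) (cong ℕ→ℚ (sym (length-++ (leaves L)))))
         (ℚP.+-mono-≤ (∣⟦⟧∣≤#leaves L) (∣⟦⟧∣≤#leaves R)))

-- Both sides are linear in x, so it suffices to compare the (closed) coefficients.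
when-cut-∪ : ∀ au bu av bv → au ∧ bu ≡ false → av ∧ bv ≡ false → ∀ x →
  when (au ∧ not av) x + when (bu ∧ not bv) x
  ≡ when ((au ∨ bu) ∧ not (av ∨ bv)) x + (when (au ∧ bv) x + when (bu ∧ av) x)
when-cut-∪ au bu av bv au∧bu≡f av∧bv≡f x = begin
  when (au ∧ not av) x + when (bu ∧ not bv) x
    ≡⟨ cong₂ _+_ (when≡when1* (au ∧ not av) x) (when≡when1* (bu ∧ not bv) x) ⟩
  c₁ * x + c₂ * x
    ≡⟨ solve 3 (λ p q x → p :* x :+ q :* x := (p :+ q) :* x) refl c₁ c₂ x ⟩
  (c₁ + c₂) * x
    ≡⟨ cong (_* x) (coefficients au bu av bv au∧bu≡f av∧bv≡f) ⟩
  (c₃ + (c₄ + c₅)) * x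
    ≡⟨ solve 4 (λ r s t x → (r :+ (s :+ t)) :* x := r :* x :+ (s :* x :+ t :* x)) refl c₃ c₄ c₅ x ⟩
  c₃ * x + (c₄ * x + c₅ * x)
    ≡⟨ sym (cong₂ _+_ (when≡when1* ((au ∨ bu) ∧ not (av ∨ bv)) x)
                      (cong₂ _+_ (when≡when1* (au ∧ bv) x) (when≡when1* (bu ∧ av) x))) ⟩
  when ((au ∨ bu) ∧ not (av ∨ bv)) x + (when (au ∧ bv) x + when (bu ∧ av) x) ∎
  where
  open ≡-Reasoning
  c₁ = when (au ∧ not av) 1ℚ
  c₂ = when (bu ∧ not bv) 1ℚ
  c₃ = when ((au ∨ bu) ∧ not (av ∨ bv)) 1ℚ
  c₄ = when (au ∧ bv) 1ℚ
  c₅ = when (bu ∧ av) 1ℚ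
  coefficients : ∀ au bu av bv → au ∧ bu ≡ false → av ∧ bv ≡ false →
    when (au ∧ not av) 1ℚ + when (bu ∧ not bv) 1ℚ
    ≡ when ((au ∨ bu) ∧ not (av ∨ bv)) 1ℚ + (when (au ∧ bv) 1ℚ + when (bu ∧ av) 1ℚ)
  coefficients true  true  _     _     () _
  coefficients _     _     true  true  _  ()
  coefficients true  false true  false _  _ = refl
  coefficients true  false false true  _  _ = refl
  coefficients true  false false false _  _ = refl
  coefficients false true  true  false _  _ = refl
  coefficients false true  false true  _  _ = refl
  coefficients false true  false false _  _ = refl
  coefficients false false true  false _  _ = refl
  coefficients false false false true  _  _ = refl
  coefficients false false false false _  _ = refl

0≡[0+0]+k*[0+0] : ∀ k → 0ℚ ≡ (0ℚ + 0ℚ) + k * (0ℚ + 0ℚ)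
0≡[0+0]+k*[0+0] = solve 1 (λ k → con 0ℚ := (con 0ℚ :+ con 0ℚ) :+ k :* (con 0ℚ :+ con 0ℚ)) refl

∣⟦⟧∣≤t : ∀ {n} (P : Tree n) {t} → #leaves P ℕ.≤ t → ∣ ⟦ P ⟧ ∣ᵖ ≤ ℕ→ℚ t
∣⟦⟧∣≤t P #P≤t = ℚP.≤-trans (∣⟦⟧∣≤#leaves P) (ℕ→ℚ-mono-≤ #P≤t)

-- Both ends of a pair of leaves of node L R lie in L, both in R, or one on each side.
when-lcaLeaves-node : ∀ c lu ru lv rv → lu ∧ ru ≡ false → lv ∧ rv ≡ false → ∀ x (a b k : ℕ) →
  when c (when ((lu ∨ ru) ∧ (lv ∨ rv)) (x * ℕ→ℚ (if lu ∧ lv then a else if ru ∧ rv then b else k)))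
  ≡ (when c (when (lu ∧ lv) (x * ℕ→ℚ a)) + when c (when (ru ∧ rv) (x * ℕ→ℚ b)))
    + ℕ→ℚ k * (when c (when (lu ∧ rv) x) + when c (when (ru ∧ lv) x))
when-lcaLeaves-node false _     _     _     _     _  _  x a b k = 0≡[0+0]+k*[0+0] (ℕ→ℚ k)
when-lcaLeaves-node true  true  true  _     _     () _  x a b k
when-lcaLeaves-node true  _     _     true  true  _  () x a b k
when-lcaLeaves-node true  true  false true  false _  _  x a b k =
  solve 2 (λ y k → y := (y :+ con 0ℚ) :+ k :* (con 0ℚ :+ con 0ℚ)) refl (x * ℕ→ℚ a) (ℕ→ℚ k)
when-lcaLeaves-node true  true  false false true  _  _  x a b k =
  solve 2 (λ x k → x :* k := (con 0ℚ :+ con 0ℚ) :+ k :* (x :+ con 0ℚ)) refl x (ℕ→ℚ k)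
when-lcaLeaves-node true  true  false false false _  _  x a b k = 0≡[0+0]+k*[0+0] (ℕ→ℚ k)
when-lcaLeaves-node true  false true  true  false _  _  x a b k =
  solve 2 (λ x k → x :* k := (con 0ℚ :+ con 0ℚ) :+ k :* (con 0ℚ :+ x)) refl x (ℕ→ℚ k)
when-lcaLeaves-node true  false true  false true  _  _  x a b k =
  solve 2 (λ y k → y := (con 0ℚ :+ y) :+ k :* (con 0ℚ :+ con 0ℚ)) refl (x * ℕ→ℚ b) (ℕ→ℚ k)
when-lcaLeaves-node true  false true  false false _  _  x a b k = 0≡[0+0]+k*[0+0] (ℕ→ℚ k)
when-lcaLeaves-node true  false false true  false _  _  x a b k = 0≡[0+0]+k*[0+0] (ℕ→ℚ k)
when-lcaLeaves-node true  false false false true  _  _  x a b k = 0≡[0+0]+k*[0+0] (ℕ→ℚ k)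
when-lcaLeaves-node true  false false false false _  _  x a b k = 0≡[0+0]+k*[0+0] (ℕ→ℚ k)

_<ᶠ_ : ∀ {n} → Fin n → Fin n → Bool
u <ᶠ v = ⌊ toℕ u ℕ.<? toℕ v ⌋

when-<ᶠ+when->ᶠ : ∀ {n} (u v : Fin n) {x} → (u ≡ v → x ≡ 0ℚ) → when (u <ᶠ v) x + when (v <ᶠ u) x ≡ x
when-<ᶠ+when->ᶠ u v {x} u≡v⇒x≡0 with toℕ u ℕ.<? toℕ v | toℕ v ℕ.<? toℕ u
... | yes u<v | yes v<u = ⊥-elim (ℕP.<-asym u<v v<u)
... | yes _   | no  _   = ℚP.+-identityʳ x
... | no  _   | yes _   = ℚP.+-identityˡ x
... | no  u≮v | no  v≮u =
  sym (u≡v⇒x≡0 (FinP.toℕ-injective (ℕP.≤-antisym (ℕP.≮⇒≥ v≮u) (ℕP.≮⇒≥ u≮v))))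

-- Volumes, cuts and costs

module _ {n : ℕ} (G : Graph n) where

  volᵖ : (Fin n → Bool) → ℚ
  volᵖ a = Σ[ (λ u → when (a u) (deg G u)) ]

  cutᵖ : (Fin n → Bool) → ℚ
  cutᵖ a = Σ²[ (λ u v → when (a u ∧ not (a v)) (w G u v)) ]

  wᵖ : (Fin n → Bool) → (Fin n → Bool) → ℚ
  wᵖ a b = Σ²[ (λ u v → when (a u ∧ b v) (w G u v)) ]

  deg-nonNeg : ∀ u → 0ℚ ≤ deg G u
  deg-nonNeg u = Σ-nonNeg (w-nonneg G u)

  volG-nonNeg : 0ℚ ≤ volG G
  volG-nonNeg = Σ-nonNeg deg-nonNeg

  volᵖ-nonNeg : ∀ a → 0ℚ ≤ volᵖ a
  volᵖ-nonNeg a = Σ-nonNeg (λ u → when-nonNeg (a u) (deg-nonNeg u))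

  cutᵖ-nonNeg : ∀ a → 0ℚ ≤ cutᵖ a
  cutᵖ-nonNeg a = Σ²-nonNeg (λ u v → when-nonNeg (a u ∧ not (a v)) (w-nonneg G u v))

  wᵖ-nonNeg : ∀ a b → 0ℚ ≤ wᵖ a b
  wᵖ-nonNeg a b = Σ²-nonNeg (λ u v → when-nonNeg (a u ∧ b v) (w-nonneg G u v))

  volᵖ-cong : ∀ {a b} → (∀ u → a u ≡ b u) → volᵖ a ≡ volᵖ b
  volᵖ-cong a≗b = Σ-cong (λ u → cong (λ x → when x (deg G u)) (a≗b u))

  cutᵖ-cong : ∀ {a b} → (∀ u → a u ≡ b u) → cutᵖ a ≡ cutᵖ b
  cutᵖ-cong a≗b = Σ²-cong (λ u v → cong₂ (λ x y → when (x ∧ not y) (w G u v)) (a≗b u) (a≗b v))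

  volG-volᵖ : ∀ a → volG G - volᵖ a ≡ volᵖ (∁ᵖ a)
  volG-volᵖ a = trans (cong (_- volᵖ a) (sym (Σ-when+Σ-when-∁ a (deg G))))
                      (solve 2 (λ x y → (x :+ y) :- x := y) refl (volᵖ a) (volᵖ (∁ᵖ a)))

  volᵖ≤volG : ∀ a → volᵖ a ≤ volG G
  volᵖ≤volG a = 0≤q-p⇒p≤q (subst (0ℚ ≤_) (sym (volG-volᵖ a)) (volᵖ-nonNeg (∁ᵖ a)))

  volᵖ-∪ : ∀ a b → volᵖ (a ∪ᵖ b) ≤ volᵖ a + volᵖ b
  volᵖ-∪ a b = Σ-when-∪ a b deg-nonNeg

  volᵖ≤c*∣∣ : ∀ a {c} → (∀ u → deg G u ≤ c) → volᵖ a ≤ c * ∣ a ∣ᵖ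
  volᵖ≤c*∣∣ a {c} deg≤c =
    subst (volᵖ a ≤_) (Σ-distribˡ-* c (λ u → when (a u) 1ℚ)) (Σ-mono-≤ (λ u → pointwise (a u) u))
    where
    pointwise : ∀ b u → when b (deg G u) ≤ c * when b 1ℚ
    pointwise true  u = subst (deg G u ≤_) (sym (ℚP.*-identityʳ c)) (deg≤c u)
    pointwise false u = ℚP.≤-reflexive (sym (ℚP.*-zeroʳ c))

  c*∣∣≤volᵖ : ∀ a {c} → (∀ u → c ≤ deg G u) → c * ∣ a ∣ᵖ ≤ volᵖ a
  c*∣∣≤volᵖ a {c} c≤deg =
    subst (_≤ volᵖ a) (Σ-distribˡ-* c (λ u → when (a u) 1ℚ)) (Σ-mono-≤ (λ u → pointwise (a u) u))
    where
    pointwise : ∀ b u → c * when b 1ℚ ≤ when b (deg G u)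
    pointwise true  u = subst (_≤ deg G u) (sym (ℚP.*-identityʳ c)) (c≤deg u)
    pointwise false u = ℚP.≤-reflexive (ℚP.*-zeroʳ c)

  -- d_u = Σ_x w_xu, and w_xu ≤ d_x for x ≠ u while w_uu = 0.
  deg+deg≤volG : ∀ u → deg G u + deg G u ≤ volG G
  deg+deg≤volG u = subst (_≤ volG G) Σ≡deg+deg (Σ-mono-≤ pointwise)
    where
    Σ≡deg+deg : Σ[ (λ x → when ⌊ x FinP.≟ u ⌋ (deg G u) + w G x u) ] ≡ deg G u + deg G u
    Σ≡deg+deg = trans (Σ-distrib-+ (λ x → when ⌊ x FinP.≟ u ⌋ (deg G u)) (λ x → w G x u))
                      (cong₂ _+_ (Σ-when-≡ (λ _ → deg G u) u) (Σ-cong (λ x → w-sym G x u)))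
    pointwise : ∀ x → when ⌊ x FinP.≟ u ⌋ (deg G u) + w G x u ≤ deg G x
    pointwise x with x FinP.≟ u
    ... | yes refl = ℚP.≤-reflexive (trans (cong (_+_ (deg G x)) (w-noloop G x)) (ℚP.+-identityʳ (deg G x)))
    ... | no  _    = subst (_≤ deg G x) (sym (ℚP.+-identityˡ (w G x u))) (term≤Σ (w-nonneg G x) u)

  cutᵖ-∁ : ∀ a → cutᵖ (∁ᵖ a) ≡ cutᵖ a
  cutᵖ-∁ a = trans (Σ²-cong (λ u v → cong₂ when (flip (a u) (a v)) (w-sym G u v)))
                   (Σ²-transpose (λ u v → when (a u ∧ not (a v)) (w G u v)))
    where
    flip : ∀ x y → not x ∧ not (not y) ≡ y ∧ not x
    flip x y = trans (cong (not x ∧_) (not-involutive y)) (∧-comm (not x) y)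

  wᵖ-comm : ∀ a b → wᵖ b a ≡ wᵖ a b
  wᵖ-comm a b = trans (Σ²-cong (λ u v → cong₂ when (∧-comm (b u) (a v)) (w-sym G u v)))
                      (Σ²-transpose (λ u v → when (a u ∧ b v) (w G u v)))

  cutᵖ-∪ : ∀ a b → (∀ u → a u ∧ b u ≡ false) → cutᵖ a + cutᵖ b ≡ cutᵖ (a ∪ᵖ b) + (wᵖ a b + wᵖ b a)
  cutᵖ-∪ a b a∩b≡∅ =
    trans (sym (Σ²-distrib-+ cut-a cut-b))
    (trans (Σ²-cong (λ u v → when-cut-∪ (a u) (b u) (a v) (b v) (a∩b≡∅ u) (a∩b≡∅ v) (w G u v)))
    (trans (Σ²-distrib-+ cut-a∪b (λ u v → w-ab u v + w-ba u v))
           (cong (_+_ (cutᵖ (a ∪ᵖ b))) (Σ²-distrib-+ w-ab w-ba))))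
    where
    cut-a cut-b cut-a∪b w-ab w-ba : Fin n → Fin n → ℚ
    cut-a   u v = when (a u ∧ not (a v)) (w G u v)
    cut-b   u v = when (b u ∧ not (b v)) (w G u v)
    cut-a∪b u v = when ((a u ∨ b u) ∧ not (a v ∨ b v)) (w G u v)
    w-ab    u v = when (a u ∧ b v) (w G u v)
    w-ba    u v = when (b u ∧ a v) (w G u v)

  splitCost : Tree n → ℚ
  splitCost (leaf _)   = 0ℚ
  splitCost (node L R) = (splitCost L + splitCost R) + ℕ→ℚ (#leaves (node L R)) * wᵖ ⟦ L ⟧ ⟦ R ⟧

  -- Restricting to pairs of leaves of T makes the cost recursive in the subtrees.
  costWithin : Tree n → ℚ
  costWithin T =
    Σ²[ (λ u v → when (u <ᶠ v) (when (⟦ T ⟧ u ∧ ⟦ T ⟧ v) (w G u v * ℕ→ℚ (lcaLeaves T u v)))) ]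

  wᵖ< : (Fin n → Bool) → (Fin n → Bool) → ℚ
  wᵖ< a b = Σ²[ (λ u v → when (u <ᶠ v) (when (a u ∧ b v) (w G u v))) ]

  wᵖ<+wᵖ<≡wᵖ : ∀ a b → wᵖ< a b + wᵖ< b a ≡ wᵖ a b
  wᵖ<+wᵖ<≡wᵖ a b = begin
    wᵖ< a b + wᵖ< b a
      ≡⟨ cong (_+_ (wᵖ< a b)) (sym (Σ²-transpose (λ u v → when (u <ᶠ v) (when (b u ∧ a v) (w G u v))))) ⟩
    wᵖ< a b + Σ²[ (λ u v → when (v <ᶠ u) (when (b v ∧ a u) (w G v u))) ]
      ≡⟨ cong (_+_ (wᵖ< a b))
              (Σ²-cong (λ u v → cong (when (v <ᶠ u)) (cong₂ when (∧-comm (b v) (a u)) (w-sym G v u)))) ⟩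
    wᵖ< a b + Σ²[ (λ u v → when (v <ᶠ u) (x u v)) ]
      ≡⟨ sym (Σ²-distrib-+ (λ u v → when (u <ᶠ v) (x u v)) (λ u v → when (v <ᶠ u) (x u v))) ⟩
    Σ²[ (λ u v → when (u <ᶠ v) (x u v) + when (v <ᶠ u) (x u v)) ]
      ≡⟨ Σ²-cong (λ u v → when-<ᶠ+when->ᶠ u v (λ { refl → x-diagonal u })) ⟩
    wᵖ a b ∎
    where
    open ≡-Reasoning
    x : Fin n → Fin n → ℚ
    x u v = when (a u ∧ b v) (w G u v)
    x-diagonal : ∀ u → x u u ≡ 0ℚ
    x-diagonal u = trans (cong (when (a u ∧ b u)) (w-noloop G u)) (when-0 (a u ∧ b u))

  cost≡costWithin : ∀ {T} → (∀ u → ⟦ T ⟧ u ≡ true) → cost G T ≡ costWithin T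
  cost≡costWithin {T} covers = Σ²-cong (λ u v → cong (when (u <ᶠ v)) (sym (within u v)))
    where
    within : ∀ u v → when (⟦ T ⟧ u ∧ ⟦ T ⟧ v) (w G u v * ℕ→ℚ (lcaLeaves T u v))
                     ≡ w G u v * ℕ→ℚ (lcaLeaves T u v)
    within u v rewrite covers u | covers v = refl

  costWithin-leaf : ∀ x → costWithin (leaf x) ≡ 0ℚ
  costWithin-leaf x = trans (Σ²-cong pointwise) (trans (Σ-cong {n} (λ _ → Σ-zero n)) (Σ-zero n))
    where
    pointwise : ∀ u v → when (u <ᶠ v) (when (⌊ u FinP.≟ x ⌋ ∧ ⌊ v FinP.≟ x ⌋) (w G u v * 1ℚ)) ≡ 0ℚ
    pointwise u v with u FinP.≟ x | v FinP.≟ x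
    ... | yes refl | yes refl =
      trans (cong (λ y → when (u <ᶠ u) (y * 1ℚ)) (w-noloop G u)) (when-0 (u <ᶠ u))
    ... | yes _    | no  _    = when-0 (u <ᶠ v)
    ... | no  _    | _        = when-0 (u <ᶠ v)

  costWithin-node : ∀ L R → (∀ u → ⟦ L ⟧ u ∧ ⟦ R ⟧ u ≡ false) →
    costWithin (node L R) ≡ (costWithin L + costWithin R) + ℕ→ℚ (#leaves (node L R)) * wᵖ ⟦ L ⟧ ⟦ R ⟧
  costWithin-node L R L∩R≡∅ = begin
    costWithin (node L R)
      ≡⟨ Σ²-cong (λ u v → when-lcaLeaves-node (u <ᶠ v) (⟦ L ⟧ u) (⟦ R ⟧ u) (⟦ L ⟧ v) (⟦ R ⟧ v)
                             (L∩R≡∅ u) (L∩R≡∅ v) (w G u v)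
                             (lcaLeaves L u v) (lcaLeaves R u v) (#leaves (node L R))) ⟩
    Σ²[ (λ u v → (inL u v + inR u v) + k * (L→R u v + R→L u v)) ]
      ≡⟨ Σ²-distrib-+ (λ u v → inL u v + inR u v) (λ u v → k * (L→R u v + R→L u v)) ⟩
    Σ²[ (λ u v → inL u v + inR u v) ] + Σ²[ (λ u v → k * (L→R u v + R→L u v)) ]
      ≡⟨ cong₂ _+_ (Σ²-distrib-+ inL inR)
                   (trans (Σ²-distribˡ-* k (λ u v → L→R u v + R→L u v))
                          (cong (_*_ k) (Σ²-distrib-+ L→R R→L))) ⟩
    (costWithin L + costWithin R) + k * (wᵖ< ⟦ L ⟧ ⟦ R ⟧ + wᵖ< ⟦ R ⟧ ⟦ L ⟧)
      ≡⟨ cong (λ y → (costWithin L + costWithin R) + k * y) (wᵖ<+wᵖ<≡wᵖ ⟦ L ⟧ ⟦ R ⟧) ⟩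
    (costWithin L + costWithin R) + k * wᵖ ⟦ L ⟧ ⟦ R ⟧ ∎
    where
    open ≡-Reasoning
    k = ℕ→ℚ (#leaves (node L R))
    inL inR L→R R→L : Fin n → Fin n → ℚ
    inL u v = when (u <ᶠ v) (when (⟦ L ⟧ u ∧ ⟦ L ⟧ v) (w G u v * ℕ→ℚ (lcaLeaves L u v)))
    inR u v = when (u <ᶠ v) (when (⟦ R ⟧ u ∧ ⟦ R ⟧ v) (w G u v * ℕ→ℚ (lcaLeaves R u v)))
    L→R u v = when (u <ᶠ v) (when (⟦ L ⟧ u ∧ ⟦ R ⟧ v) (w G u v))
    R→L u v = when (u <ᶠ v) (when (⟦ R ⟧ u ∧ ⟦ L ⟧ v) (w G u v))

  costWithin≡splitCost : ∀ T → DisjointSplits T → costWithin T ≡ splitCost T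
  costWithin≡splitCost (leaf x)   _                   = costWithin-leaf x
  costWithin≡splitCost (node L R) (dL , dR , L∩R≡∅) = trans (costWithin-node L R L∩R≡∅)
    (cong (_+ ℕ→ℚ (#leaves (node L R)) * wᵖ ⟦ L ⟧ ⟦ R ⟧)
          (cong₂ _+_ (costWithin≡splitCost L dL) (costWithin≡splitCost R dR)))

  cost≡splitCost : ∀ T → IsHCTree T → cost G T ≡ splitCost T
  cost≡splitCost T T↭V = trans (cost≡costWithin {T} (IsHCTree⇒∈ᵀ T T↭V))
                               (costWithin≡splitCost T (IsHCTree⇒DisjointSplits T T↭V))

  cost-nonNeg : ∀ T → 0ℚ ≤ cost G T
  cost-nonNeg T =
    Σ²-nonNeg (λ u v → when-nonNeg (u <ᶠ v) (*-nonNeg (w-nonneg G u v) (ℕ→ℚ-nonNeg (lcaLeaves T u v))))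

  crossing : ℕ → Tree n → ℚ
  crossing t (leaf _)   = 0ℚ
  crossing t (node L R) =
    when (t <ᵇ #leaves (node L R)) ((crossing t L + crossing t R) + (wᵖ ⟦ L ⟧ ⟦ R ⟧ + wᵖ ⟦ R ⟧ ⟦ L ⟧))

  crossing-nonNeg : ∀ t T → 0ℚ ≤ crossing t T
  crossing-nonNeg t (leaf _)   = ℚP.≤-refl
  crossing-nonNeg t (node L R) = when-nonNeg (t <ᵇ #leaves (node L R))
    (+-nonNeg (+-nonNeg (crossing-nonNeg t L) (crossing-nonNeg t R))
              (+-nonNeg (wᵖ-nonNeg ⟦ L ⟧ ⟦ R ⟧) (wᵖ-nonNeg ⟦ R ⟧ ⟦ L ⟧)))

  -- A node with k leaves contributes to crossing t for exactly the k thresholds t < k.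
  Σ<crossing≤2splitCost : ∀ K T → Σ< K (λ t → crossing t T) ≤ splitCost T + splitCost T
  Σ<crossing≤2splitCost K (leaf _)   = ℚP.≤-reflexive (Σ-zero K)
  Σ<crossing≤2splitCost K (node L R) = begin
    Σ< K (λ t → crossing t (node L R))
      ≤⟨ Σ-mono-≤ {K} (λ i → pointwise (toℕ i)) ⟩
    Σ< K (λ t → (crossing t L + crossing t R) + X * small t)
      ≡⟨ trans (Σ-distrib-+ {K} (λ i → crossing (toℕ i) L + crossing (toℕ i) R) (λ i → X * small (toℕ i)))
               (cong₂ _+_ (Σ-distrib-+ {K} (λ i → crossing (toℕ i) L) (λ i → crossing (toℕ i) R))
                          (Σ-distribˡ-* {K} X (λ i → small (toℕ i)))) ⟩
    (Σ< K (λ t → crossing t L) + Σ< K (λ t → crossing t R)) + X * Σ< K small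
      ≤⟨ ℚP.+-mono-≤ (ℚP.+-mono-≤ (Σ<crossing≤2splitCost K L) (Σ<crossing≤2splitCost K R))
                     (*-monoʳ-≤-0≤ 0≤X (Σ<-when-<ᵇ K (#leaves (node L R)))) ⟩
    ((sL + sL) + (sR + sR)) + X * k
      ≡⟨ cong (λ y → ((sL + sL) + (sR + sR)) + (x + y) * k) (wᵖ-comm ⟦ L ⟧ ⟦ R ⟧) ⟩
    ((sL + sL) + (sR + sR)) + (x + x) * k
      ≡⟨ solve 4 (λ a b x k → ((a :+ a) :+ (b :+ b)) :+ (x :+ x) :* k
                              := ((a :+ b) :+ k :* x) :+ ((a :+ b) :+ k :* x)) refl sL sR x k ⟩
    splitCost (node L R) + splitCost (node L R) ∎
    where
    open ℚP.≤-Reasoning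
    sL = splitCost L
    sR = splitCost R
    x = wᵖ ⟦ L ⟧ ⟦ R ⟧
    X = wᵖ ⟦ L ⟧ ⟦ R ⟧ + wᵖ ⟦ R ⟧ ⟦ L ⟧
    k = ℕ→ℚ (#leaves (node L R))
    small : ℕ → ℚ
    small t = when (t <ᵇ #leaves (node L R)) 1ℚ
    0≤X : 0ℚ ≤ X
    0≤X = +-nonNeg (wᵖ-nonNeg ⟦ L ⟧ ⟦ R ⟧) (wᵖ-nonNeg ⟦ R ⟧ ⟦ L ⟧)
    pointwise : ∀ t → crossing t (node L R) ≤ (crossing t L + crossing t R) + X * small t
    pointwise t with t <ᵇ #leaves (node L R)
    ... | true  = ℚP.≤-reflexive (cong (_+_ (crossing t L + crossing t R)) (sym (ℚP.*-identityʳ X)))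
    ... | false = subst (0ℚ ≤_) (cong (_+_ (crossing t L + crossing t R)) (sym (ℚP.*-zeroʳ X)))
                        (+-nonNeg (+-nonNeg (crossing-nonNeg t L) (crossing-nonNeg t R)) ℚP.≤-refl)

-- Conductance

  module _ {Φ : ℚ} (isΦ : IsConductance G Φ) where

    Φ-nonNeg : 0ℚ ≤ Φ
    Φ-nonNeg with proj₁ isΦ
    ... | S , _ , 0<volS , Φ≡ =
      subst (0ℚ ≤_) (sym Φ≡) (*-nonNeg (cutᵖ-nonNeg (lookup S)) (ℚP.<⇒≤ (1/-pos 0<volS)))

    module _ (pos : ∀ u → 0ℚ < deg G u) where

      conductance-bound : ∀ S → vol G S + vol G S ≤ volG G → Φ * vol G S ≤ cut G S
      conductance-bound S 2volS≤V with nonempty? S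
      ... | no ¬nonempty =
        subst (_≤ cut G S) (sym (trans (cong (Φ *_) volS≡0) (ℚP.*-zeroʳ Φ))) (cutᵖ-nonNeg (lookup S))
        where
        outside : ∀ u → when (lookup S u) (deg G u) ≡ 0ℚ
        outside u with lookup S u in u∈S
        ... | true  = ⊥-elim (¬nonempty (u , lookup⇒[]= u S u∈S))
        ... | false = refl
        volS≡0 : vol G S ≡ 0ℚ
        volS≡0 = trans (Σ-cong outside) (Σ-zero n)
      ... | yes (u , u∈S) = subst (Φ * vol G S ≤_) (÷-*-cancel (cut G S) (vol G S) {{>-nonZero 0<volS}})
                              (ℚP.*-monoʳ-≤-nonNeg (vol G S) {{nonNegative (ℚP.<⇒≤ 0<volS)}}
                                (proj₂ isΦ S ((u , u∈S) , volS≤½V) 0<volS))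
        where
        0<volS : 0ℚ < vol G S
        0<volS = ℚP.<-≤-trans (pos u)
          (subst (_≤ vol G S) (cong (λ b → when b (deg G u)) ([]=⇒lookup u∈S))
                 (term≤Σ (λ x → when-nonNeg (lookup S x) (deg-nonNeg x)) u))
        volS≤½V : vol G S ≤ ½ * volG G
        volS≤½V = subst (_≤ ½ * volG G) (solve 1 (λ x → con ½ :* (x :+ x) := x) refl (vol G S))
                        (*-monoʳ-≤-0≤ {½} (ℚP.≤ᵇ⇒≤ tt) 2volS≤V)

      conductance-boundᵖ : ∀ a → volᵖ a + volᵖ a ≤ volG G → Φ * volᵖ a ≤ cutᵖ a
      conductance-boundᵖ a 2vola≤V = subst₂ (λ x y → Φ * x ≤ y) (volᵖ-cong a≗a) (cutᵖ-cong a≗a)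
        (conductance-bound (tabulate a) (subst (λ x → x + x ≤ volG G) (sym (volᵖ-cong a≗a)) 2vola≤V))
        where
        a≗a = lookup∘tabulate a

      -- A set of more than half the volume is handled through its complement.
      conductance-bound-⊓ : ∀ a {C} → (volᵖ a + volᵖ a ≤ volG G) ⊎ (C ≤ volG G - volᵖ a) →
                            Φ * (volᵖ a ⊓ C) ≤ cutᵖ a
      conductance-bound-⊓ a {C} small⊎C≤∁ with volᵖ a + volᵖ a ℚP.≤? volG G | small⊎C≤∁
      ... | yes small | _ =
        ℚP.≤-trans (*-monoʳ-≤-0≤ Φ-nonNeg (ℚP.p⊓q≤p (volᵖ a) C)) (conductance-boundᵖ a small)
      ... | no  large | inj₁ small = ⊥-elim (large small)
      ... | no  large | inj₂ C≤∁ = ℚP.≤-trans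
        (*-monoʳ-≤-0≤ Φ-nonNeg (ℚP.≤-trans (ℚP.p⊓q≤q (volᵖ a) C) (subst (C ≤_) (volG-volᵖ a) C≤∁)))
        (subst (Φ * volᵖ (∁ᵖ a) ≤_) (cutᵖ-∁ a) (conductance-boundᵖ (∁ᵖ a) ∁small))
        where
        ∁small : volᵖ (∁ᵖ a) + volᵖ (∁ᵖ a) ≤ volG G
        ∁small = subst (λ x → x + x ≤ volG G) (volG-volᵖ a)
          (≤-by-difference (p≤q⇒0≤q-p (ℚP.<⇒≤ (ℚP.≰⇒> large)))
            (solve 2 (λ V v → V :- ((V :- v) :+ (V :- v)) := (v :+ v) :- V) refl (volG G) (volᵖ a)))

      crossing-bound : ∀ t {C} → 0ℚ ≤ C → (∀ P → #leaves P ℕ.≤ t → C ≤ volG G - volᵖ ⟦ P ⟧) →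
                       ∀ T → DisjointSplits T → Φ * (volᵖ ⟦ T ⟧ ⊓ C) ≤ crossing t T + cutᵖ ⟦ T ⟧
      crossing-bound t {C} 0≤C small⇒C≤∁ (leaf u) _ =
        subst (Φ * (volᵖ ⟦ leaf u ⟧ ⊓ C) ≤_) (sym (ℚP.+-identityˡ (cutᵖ ⟦ leaf u ⟧)))
          (conductance-bound-⊓ ⟦ leaf u ⟧
            (inj₁ (subst (λ x → x + x ≤ volG G) (sym (Σ-when-≡ (deg G) u)) (deg+deg≤volG u))))
      crossing-bound t {C} 0≤C small⇒C≤∁ (node L R) (dL , dR , L∩R≡∅) with t <ᵇ #leaves (node L R) in t<N
      ... | false = subst (Φ * (volᵖ ⟦ node L R ⟧ ⊓ C) ≤_) (sym (ℚP.+-identityˡ (cutᵖ ⟦ node L R ⟧)))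
          (conductance-bound-⊓ ⟦ node L R ⟧ (inj₂ (small⇒C≤∁ (node L R) (<ᵇ≡false⇒≥ t<N))))
      ... | true = begin
        Φ * (volᵖ ⟦ node L R ⟧ ⊓ C)
          ≤⟨ *-monoʳ-≤-0≤ Φ-nonNeg
               (⊓-subadditive C (volᵖ-nonNeg ⟦ L ⟧) (volᵖ-nonNeg ⟦ R ⟧) 0≤C (volᵖ-∪ ⟦ L ⟧ ⟦ R ⟧)) ⟩
        Φ * (volᵖ ⟦ L ⟧ ⊓ C + volᵖ ⟦ R ⟧ ⊓ C)
          ≡⟨ ℚP.*-distribˡ-+ Φ (volᵖ ⟦ L ⟧ ⊓ C) (volᵖ ⟦ R ⟧ ⊓ C) ⟩
        Φ * (volᵖ ⟦ L ⟧ ⊓ C) + Φ * (volᵖ ⟦ R ⟧ ⊓ C)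
          ≤⟨ ℚP.+-mono-≤ (crossing-bound t 0≤C small⇒C≤∁ L dL) (crossing-bound t 0≤C small⇒C≤∁ R dR) ⟩
        (crossing t L + cutᵖ ⟦ L ⟧) + (crossing t R + cutᵖ ⟦ R ⟧)
          ≡⟨ solve 4 (λ a b c d → (a :+ b) :+ (c :+ d) := (a :+ c) :+ (b :+ d)) refl
                     (crossing t L) (cutᵖ ⟦ L ⟧) (crossing t R) (cutᵖ ⟦ R ⟧) ⟩
        (crossing t L + crossing t R) + (cutᵖ ⟦ L ⟧ + cutᵖ ⟦ R ⟧)
          ≡⟨ cong (_+_ (crossing t L + crossing t R)) (cutᵖ-∪ ⟦ L ⟧ ⟦ R ⟧ L∩R≡∅) ⟩
        (crossing t L + crossing t R) + (cutᵖ ⟦ node L R ⟧ + X)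
          ≡⟨ solve 3 (λ a c x → a :+ (c :+ x) := (a :+ x) :+ c) refl
                     (crossing t L + crossing t R) (cutᵖ ⟦ node L R ⟧) X ⟩
        ((crossing t L + crossing t R) + X) + cutᵖ ⟦ node L R ⟧ ∎
        where
        open ℚP.≤-Reasoning
        X = wᵖ ⟦ L ⟧ ⟦ R ⟧ + wᵖ ⟦ R ⟧ ⟦ L ⟧

      Φ*Σ<≤2cost : ∀ T → IsHCTree T → ∀ K (C : ℕ → ℚ) → (∀ t → 0ℚ ≤ C t) → (∀ t → C t ≤ volG G) →
                   (∀ t P → #leaves P ℕ.≤ t → C t ≤ volG G - volᵖ ⟦ P ⟧) →
                   Φ * Σ< K C ≤ cost G T + cost G T
      Φ*Σ<≤2cost T T↭V K C 0≤C C≤V small⇒C≤∁ = begin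
        Φ * Σ< K C                  ≡⟨ sym (Σ-distribˡ-* {K} Φ (λ i → C (toℕ i))) ⟩
        Σ< K (λ t → Φ * C t)        ≤⟨ Σ-mono-≤ {K} (λ i → Φ*C≤crossing (toℕ i)) ⟩
        Σ< K (λ t → crossing t T)   ≤⟨ Σ<crossing≤2splitCost K T ⟩
        splitCost T + splitCost T   ≡⟨ sym (cong₂ _+_ (cost≡splitCost T T↭V) (cost≡splitCost T T↭V)) ⟩
        cost G T + cost G T         ∎
        where
        open ℚP.≤-Reasoning
        covers = IsHCTree⇒∈ᵀ T T↭V
        cutT≡0 : cutᵖ ⟦ T ⟧ ≡ 0ℚ
        cutT≡0 = trans (cutᵖ-cong covers) (trans (Σ-cong {n} (λ _ → Σ-zero n)) (Σ-zero n))
        Φ*C≤crossing : ∀ t → Φ * C t ≤ crossing t T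
        Φ*C≤crossing t = subst₂ _≤_
          (cong (Φ *_) (trans (cong (_⊓ C t) (volᵖ-cong covers)) (ℚP.p≥q⇒p⊓q≡q (C≤V t))))
          (trans (cong (_+_ (crossing t T)) cutT≡0) (ℚP.+-identityʳ (crossing t T)))
          (crossing-bound t (0≤C t) (small⇒C≤∁ t) T (IsHCTree⇒DisjointSplits T T↭V))

-- Degree bounds

module _ {m : ℕ} (G : Graph (suc m)) where

  volG≤n*dmax : volG G ≤ ℕ⁺→ℚ m * dmax G
  volG≤n*dmax = subst (volG G ≤_) (trans (cong (dmax G *_) (Σ-one (suc m))) (ℚP.*-comm (dmax G) (ℕ⁺→ℚ m)))
                      (volᵖ≤c*∣∣ G (λ _ → true) (maxF-upper (deg G)))

  n*dmin≤volG : ℕ⁺→ℚ m * dmin G ≤ volG G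
  n*dmin≤volG = subst (_≤ volG G) (trans (cong (dmin G *_) (Σ-one (suc m))) (ℚP.*-comm (dmin G) (ℕ⁺→ℚ m)))
                      (c*∣∣≤volᵖ G (λ _ → true) (minF-lower (deg G)))

  dmin-nonNeg : 0ℚ ≤ dmin G
  dmin-nonNeg = minF-glb (deg G) (deg-nonNeg G)

  module _ (pos : ∀ u → 0ℚ < deg G u) {Φ} (isΦ : IsConductance G Φ)
           (T : Tree (suc m)) (T↭V : IsHCTree T) where

    Φ*volG²/dmax≤4cost : Φ * (_÷_ (volG G * volG G) (dmax G) {{>-nonZero (dmax-pos G pos)}})
                         ≤ (cost G T + cost G T) + (cost G T + cost G T)
    Φ*volG²/dmax≤4cost = begin
      Φ * ((V * V) ÷ D)  ≤⟨ *-monoʳ-≤-0≤ (Φ-nonNeg G isΦ) (x≤[D+D]*s⇒x÷D≤s+s 0<D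
                              (V²≤2D*Σ<ramp (suc m) (volG-nonNeg G) (ℚP.<⇒≤ 0<D) (volG≤n*dmax))) ⟩
      Φ * (S + S)        ≡⟨ ℚP.*-distribˡ-+ Φ S S ⟩
      Φ * S + Φ * S      ≤⟨ ℚP.+-mono-≤ Φ*S≤2cost Φ*S≤2cost ⟩
      (cost G T + cost G T) + (cost G T + cost G T) ∎
      where
      open ℚP.≤-Reasoning
      V = volG G
      D = dmax G
      0<D = dmax-pos G pos
      instance
        D≢0 : NonZero D
        D≢0 = >-nonZero 0<D
      S = Σ< (suc m) (ramp V D)
      ramp≤V : ∀ t → ramp V D t ≤ V
      ramp≤V t = ℚP.⊔-lub (volG-nonNeg G) (≤-by-difference (*-nonNeg (ℕ→ℚ-nonNeg t) (ℚP.<⇒≤ 0<D))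
                   (solve 3 (λ V k D → V :- (V :- k :* D) := k :* D) refl V (ℕ→ℚ t) D))
      ramp≤vol∁ : ∀ t P → #leaves P ℕ.≤ t → ramp V D t ≤ V - volᵖ G ⟦ P ⟧
      ramp≤vol∁ t P #P≤t =
        ℚP.⊔-lub (p≤q⇒0≤q-p (volᵖ≤volG G ⟦ P ⟧)) (ℚP.+-monoʳ-≤ V (ℚP.neg-antimono-≤ volP≤tD))
        where
        volP≤tD : volᵖ G ⟦ P ⟧ ≤ ℕ→ℚ t * D
        volP≤tD = ℚP.≤-trans (volᵖ≤c*∣∣ G ⟦ P ⟧ (maxF-upper (deg G)))
          (subst (D * ∣ ⟦ P ⟧ ∣ᵖ ≤_) (ℚP.*-comm D (ℕ→ℚ t)) (*-monoʳ-≤-0≤ (ℚP.<⇒≤ 0<D) (∣⟦⟧∣≤t P #P≤t)))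
      Φ*S≤2cost : Φ * S ≤ cost G T + cost G T
      Φ*S≤2cost = Φ*Σ<≤2cost G isΦ pos T T↭V (suc m) (ramp V D) (ramp-nonNeg V D) ramp≤V ramp≤vol∁

    Φ*dmin*n²≤4cost : Φ * (dmin G * (ℕ⁺→ℚ m * ℕ⁺→ℚ m)) ≤ (cost G T + cost G T) + (cost G T + cost G T)
    Φ*dmin*n²≤4cost = begin
      Φ * (d * (N * N))  ≤⟨ *-monoʳ-≤-0≤ (Φ-nonNeg G isΦ) (*-monoʳ-≤-0≤ dmin-nonNeg (N²≤2*Σ<[N∸t] (suc m))) ⟩
      Φ * (d * (S + S))  ≡⟨ cong (Φ *_) (trans (ℚP.*-distribˡ-+ d S S) (cong₂ _+_ d*S≡ΣC d*S≡ΣC)) ⟩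
      Φ * (ΣC + ΣC)      ≡⟨ ℚP.*-distribˡ-+ Φ ΣC ΣC ⟩
      Φ * ΣC + Φ * ΣC    ≤⟨ ℚP.+-mono-≤ Φ*ΣC≤2cost Φ*ΣC≤2cost ⟩
      (cost G T + cost G T) + (cost G T + cost G T) ∎
      where
      open ℚP.≤-Reasoning
      d = dmin G
      N = ℕ⁺→ℚ m
      S = Σ< (suc m) (λ t → ℕ→ℚ (suc m ∸ t))
      C : ℕ → ℚ
      C t = d * ℕ→ℚ (suc m ∸ t)
      ΣC = Σ< (suc m) C
      d*S≡ΣC : d * S ≡ ΣC
      d*S≡ΣC = sym (Σ-distribˡ-* {suc m} d (λ i → ℕ→ℚ (suc m ∸ toℕ i)))
      C≤V : ∀ t → C t ≤ volG G
      C≤V t = ℚP.≤-trans (*-monoʳ-≤-0≤ dmin-nonNeg (ℕ→ℚ-mono-≤ (ℕP.m∸n≤m (suc m) t)))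
                         (subst (_≤ volG G) (ℚP.*-comm N d) n*dmin≤volG)
      C≤vol∁ : ∀ t P → #leaves P ℕ.≤ t → C t ≤ volG G - volᵖ G ⟦ P ⟧
      C≤vol∁ t P #P≤t = subst (C t ≤_) (sym (volG-volᵖ G ⟦ P ⟧))
        (ℚP.≤-trans (*-monoʳ-≤-0≤ dmin-nonNeg (∣∁∣≥n∸t ⟦ P ⟧ t (∣⟦⟧∣≤t P #P≤t)))
                    (c*∣∣≤volᵖ G (∁ᵖ ⟦ P ⟧) (minF-lower (deg G))))
      Φ*ΣC≤2cost : Φ * ΣC ≤ cost G T + cost G T
      Φ*ΣC≤2cost = Φ*Σ<≤2cost G isΦ pos T T↭V (suc m) C (λ t → *-nonNeg dmin-nonNeg (ℕ→ℚ-nonNeg (suc m ∸ t)))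
                              C≤V C≤vol∁

0≤2/9 : 0ℚ ≤ + 2 / 9
0≤2/9 = ℚP.≤ᵇ⇒≤ tt

2/9*Φ*⊔≤ : ∀ {Φ X Y κ} → 0ℚ ≤ Φ → 0ℚ ≤ κ →
           Φ * X ≤ (κ + κ) + (κ + κ) → Φ * Y ≤ (κ + κ) + (κ + κ) → (+ 2 / 9) * Φ * (X ⊔ Y) ≤ κ
2/9*Φ*⊔≤ {Φ} {X} {Y} {κ} 0≤Φ 0≤κ ΦX≤4κ ΦY≤4κ =
  subst (_≤ κ) (sym (ℚP.*-distribˡ-⊔-nonNeg c {{nonNegative 0≤c}} X Y))
        (ℚP.⊔-lub (scaled ΦX≤4κ) (scaled ΦY≤4κ))
  where
  c = (+ 2 / 9) * Φ
  0≤c : 0ℚ ≤ c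
  0≤c = *-nonNeg 0≤2/9 0≤Φ
  scaled : ∀ {Z} → Φ * Z ≤ (κ + κ) + (κ + κ) → c * Z ≤ κ
  scaled {Z} ΦZ≤4κ = begin
    c * Z                           ≡⟨ ℚP.*-assoc (+ 2 / 9) Φ Z ⟩
    (+ 2 / 9) * (Φ * Z)             ≤⟨ *-monoʳ-≤-0≤ 0≤2/9 ΦZ≤4κ ⟩
    (+ 2 / 9) * ((κ + κ) + (κ + κ)) ≤⟨ ≤-by-difference (*-nonNeg {+ 1 / 9} (ℚP.≤ᵇ⇒≤ tt) 0≤κ)
      (solve 1 (λ κ → κ :- con (+ 2 / 9) :* ((κ :+ κ) :+ (κ :+ κ)) := con (+ 1 / 9) :* κ) refl κ) ⟩
    κ                               ∎
    where open ℚP.≤-Reasoning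

⊔-rescale-by-average : ∀ c N V d D .{{_ : NonZero N}} .{{_ : NonZero D}} .{{_ : NonZero (V ÷ N)}} →
  0ℚ ≤ c → 0ℚ ≤ N → 0ℚ ≤ V →
  c * ((V * V) ÷ D ⊔ d * (N * N)) ≡ c * N * V * ((V ÷ N) ÷ D ⊔ d ÷ (V ÷ N))
⊔-rescale-by-average c N V d D 0≤c 0≤N 0≤V =
  trans (ℚP.*-distribˡ-⊔-nonNeg c {{nonNegative 0≤c}} ((V * V) ÷ D) (d * (N * N)))
  (trans (cong₂ _⊔_ (sym first) (sym second))
         (sym (ℚP.*-distribˡ-⊔-nonNeg k {{nonNegative 0≤k}} ((V ÷ N) ÷ D) (d ÷ (V ÷ N)))))
  where
  open ≡-Reasoning
  k = c * N * V
  0≤k : 0ℚ ≤ k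
  0≤k = *-nonNeg (*-nonNeg 0≤c 0≤N) 0≤V
  iN = 1/ N
  iD = 1/ D
  iA = 1/ (V ÷ N)
  first : k * ((V ÷ N) ÷ D) ≡ c * ((V * V) ÷ D)
  first = begin
    k * (V * iN * iD)            ≡⟨ solve 5 (λ c N V iN iD → c :* N :* V :* (V :* iN :* iD)
                                                         := (c :* (V :* V :* iD)) :* (N :* iN)) refl c N V iN iD ⟩
    c * (V * V * iD) * (N * iN)  ≡⟨ x*[p*1/p]≡x (c * (V * V * iD)) N ⟩
    c * (V * V * iD)             ∎
  second : k * (d ÷ (V ÷ N)) ≡ c * (d * (N * N))
  second = begin
    k * (d * iA)                       ≡⟨ sym (x*[p*1/p]≡x (k * (d * iA)) N) ⟩
    k * (d * iA) * (N * iN)            ≡⟨ solve 6 (λ c N V d iA iN → c :* N :* V :* (d :* iA) :* (N :* iN)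
                                                  := (c :* (d :* (N :* N))) :* ((V :* iN) :* iA))
                                                refl c N V d iA iN ⟩
    c * (d * (N * N)) * (V ÷ N * iA)   ≡⟨ x*[p*1/p]≡x (c * (d * (N * N))) (V ÷ N) ⟩
    c * (d * (N * N))                  ∎

lemma3p2 : (m : ℕ) (G : Graph (suc m)) (pos : ∀ u → 0ℚ < deg G u)
    (Φ : ℚ) → IsConductance G Φ →
    (T : Tree (suc m)) → IsOptimal G T →
    let n = ℕ⁺→ℚ m
        c = (+ 2 / 9) * Φ
        A = c * ((_÷_ (volG G * volG G) (dmax G) {{>-nonZero (dmax-pos G pos)}})
                 ⊔ (dmin G * (n * n)))
    in (A ≤ cost G T)
       × (A ≡ c * n * volG G
                * ((_÷_ (davg G) (dmax G) {{>-nonZero (dmax-pos G pos)}})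
                   ⊔ (_÷_ (dmin G) (davg G) {{>-nonZero (davg-pos G pos)}})))
lemma3p2 m G pos Φ isΦ T (T↭V , _) =
    2/9*Φ*⊔≤ (Φ-nonNeg G isΦ) (cost-nonNeg G T)
      (Φ*volG²/dmax≤4cost G pos isΦ T T↭V) (Φ*dmin*n²≤4cost G pos isΦ T T↭V)
  , ⊔-rescale-by-average ((+ 2 / 9) * Φ) (ℕ⁺→ℚ m) (volG G) (dmin G) (dmax G)
      {{ℚP.pos⇒nonZero (ℕ⁺→ℚ m)}} {{>-nonZero (dmax-pos G pos)}} {{>-nonZero (davg-pos G pos)}}
      (*-nonNeg 0≤2/9 (Φ-nonNeg G isΦ)) (ℕ→ℚ-nonNeg (suc m)) (volG-nonNeg G)
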